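{- Let $k\in\mathbb{N}$, $z\in\mathbb{C}$, and $X_{2k+2}=\{b_1,\dots,b_{2k+2}\}$ with $b_j=\frac{j-1}{k}$ for $1\le j\le k$, $b_{k+1}=\frac12-\frac{1+z}{2k}$, $b_j=2+\frac{3-2j}{2k}$ for $k+2\le j\le 2k+1$, $b_{2k+2}=1-\frac{1+z}{2k}$. Then for $1\le m\le 2k+2$, \[ \sum_{j=0}^{2k+2-m}(-2k)^je_j(X_{2k+2})S(2k+2-j,m)=\begin{cases}1,& m=2k+2,\\ 2z+k+3,& m=2k+1,\\ (z+1)(z+k+1),& m=2k,\\ 0,&1\le m\le 2k-1.\end{cases} \]
   Context: For a multiset $X_n=\{x_1,\dots,x_n\}$, $e_\ell(X_n):=\sum_{1\le j_1<\dots<j_\ell\le n}\prod_{r=1}^{\ell}x_{j_r}$ is the $\ell$-th elementary symmetric polynomial ($e_0=1$). $S(n,k)$ is the Stirling number of the second kind (number of partitions of $\{1,\dots,n\}$ into exactly $k$ nonempty blocks). -}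

module Defs where

open import Level using (Level)
open import Data.Nat as ℕ using (ℕ; zero; suc; _∸_; _≤ᵇ_; _≡ᵇ_)
open import Data.Bool using (if_then_else_)
open import Data.List using (List; []; _∷_; map; upTo)
open import Algebra.Bundles using (CommutativeRing)

S : ℕ → ℕ → ℕ
S zero    zero    = 1
S zero    (suc k) = 0
S (suc n) zero    = 0
S (suc n) (suc k) = suc k ℕ.* S n (suc k) ℕ.+ S n k

module RingDefs {c ℓ : Level} (R : CommutativeRing c ℓ) where
  open CommutativeRing R hiding (zero)

  ι : ℕ → Carrier
  ι zero    = 0#
  ι (suc n) = 1# + ι n

  pow : Carrier → ℕ → Carrier
  pow x zero    = 1#
  pow x (suc n) = x * pow x n

  e : ℕ → List Carrier → Carrier
  e zero    _        = 1#
  e (suc l) []       = 0#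
  e (suc l) (x ∷ xs) = x * e l xs + e (suc l) xs

  sumTo : ℕ → (ℕ → Carrier) → Carrier
  sumTo zero    f = f zero
  sumTo (suc N) f = sumTo N f + f (suc N)

  -- b_j (1 ≤ j ≤ 2k+2), with ik playing 1/k and i2 playing 1/2
  b : (k : ℕ) (z ik i2 : Carrier) → ℕ → Carrier
  b k z ik i2 j =
    if j ≤ᵇ k then ι (j ∸ 1) * ik
    else if j ≡ᵇ suc k then i2 - (1# + z) * (i2 * ik)
    else if j ≤ᵇ suc (2 ℕ.* k) then ι 2 - ι (2 ℕ.* j ∸ 3) * (i2 * ik)
    else 1# - (1# + z) * (i2 * ik)

  X : (k : ℕ) (z ik i2 : Carrier) → List Carrier
  X k z ik i2 = map (λ i → b k z ik i2 (suc i)) (upTo (2 ℕ.+ 2 ℕ.* k))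

  LHS : (k : ℕ) (z ik i2 : Carrier) (m : ℕ) → Carrier
  LHS k z ik i2 m =
    sumTo (2 ℕ.+ 2 ℕ.* k ∸ m) (λ j →
      pow (- ι (2 ℕ.* k)) j * e j (X k z ik i2) * ι (S (2 ℕ.+ 2 ℕ.* k ∸ j) m))

{-# OPTIONS --safe #-}
module Submission where

-- Read a sequence C : ℕ → R as the polynomial Σ_m C m · x⁽ᵐ⁾ in the falling-factorial
-- basis. Then Σ_j e_j(y) S(n - j, m) is the coefficient of x⁽ᵐ⁾ in ∏ (x + y_i), because the
-- recurrence of S says that multiplication by x sends x⁽ᵐ⁾ to x⁽ᵐ⁺¹⁾ + m x⁽ᵐ⁾.
-- Scaling by s = -2k, the numbers s·b_j are 0, -2, …, -2(k-1) for j ≤ k and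
-- -(2k-1), …, -3, -1 for k+2 ≤ j ≤ 2k+1; these factors multiply to x⁽²ᵏ⁾. The remaining
-- two, s·b_{k+1} = 1 + z - k and s·b_{2k+2} = 1 + z - 2k, turn it into
-- x⁽²ᵏ⁺²⁾ + (2z + k + 3) x⁽²ᵏ⁺¹⁾ + (z + 1)(z + k + 1) x⁽²ᵏ⁾, whose coefficients give the four cases.

open import Defs
open import Level using (Level)
open import Algebra.Bundles using (CommutativeRing)
open import Data.Bool using (Bool; true; false; T; if_then_else_)
open import Data.Unit using (tt)
open import Relation.Nullary using (¬_)
open import Data.Maybe using (nothing)
open import Data.Nat using (ℕ; _≤_; _∸_)
open import Data.Nat as ℕ using (zero; suc; _<_; s≤s; z≤n; NonZero; _≤ᵇ_; _≡ᵇ_)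
open import Data.Integer as ℤ using (ℤ; +_; -[1+_])
import Data.Integer.Properties as ℤ
import Data.Nat.Properties as ℕ
open import Data.Product using (_×_; _,_)
open import Data.Vec using (Vec)
open import Relation.Binary.PropositionalEquality as ≡ using (_≡_; _≢_; ≢-sym)
open import Data.Empty using (⊥-elim)
open import Data.Sum using (inj₁; inj₂)
open import Data.List using (List; []; _∷_; foldr; map; applyUpTo; upTo; length)
open import Data.List.Properties using (length-map; length-upTo; map-∘; map-upTo)
open import Function using (_∘_)
open import Tactic.RingSolver.Core.AlmostCommutativeRing using (fromCommutativeRing)
open import Tactic.RingSolver.Core.Polynomial.Parameters using (Homomorphism)

module IntegerCoefficientSolver {c ℓ : Level} (R : CommutativeRing c ℓ) where
  open CommutativeRing R
  open RingDefs R using (ι)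
  open import Algebra.Properties.Semiring.Mult semiring using (×-homo-+; ×1-homo-*) renaming (_×_ to _×ₙ_)
  open import Algebra.Properties.Ring ring using (-‿distribˡ-*; -‿distribʳ-*)
  open import Algebra.Properties.AbelianGroup +-abelianGroup using (⁻¹-involutive; ε⁻¹≈ε; ⁻¹-∙-comm)
  open import Algebra.Properties.CommutativeSemigroup +-commutativeSemigroup using (interchange)
  open import Relation.Binary.Reasoning.Setoid setoid

  ι≡×1# : ∀ n → ι n ≡ n ×ₙ 1#
  ι≡×1# zero    = ≡.refl
  ι≡×1# (suc n) = ≡.cong (_+_ 1#) (ι≡×1# n)

  ι-+ : ∀ m n → ι (m ℕ.+ n) ≈ ι m + ι n
  ι-+ m n rewrite ι≡×1# (m ℕ.+ n) | ι≡×1# m | ι≡×1# n = ×-homo-+ 1# m n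

  ι-* : ∀ m n → ι (m ℕ.* n) ≈ ι m * ι n
  ι-* m n rewrite ι≡×1# (m ℕ.* n) | ι≡×1# m | ι≡×1# n = ×1-homo-* m n

  ιℤ : ℤ → Carrier
  ιℤ (+ n)     = ι n
  ιℤ -[1+ n ] = - ι (suc n)

  ιℤ-neg : ∀ i → ιℤ (ℤ.- i) ≈ - ιℤ i
  ιℤ-neg -[1+ n ]     = sym (⁻¹-involutive _)
  ιℤ-neg (+ zero)     = sym ε⁻¹≈ε
  ιℤ-neg (+ (suc n)) = refl

  ιℤ-⊖ : ∀ m n → ιℤ (m ℤ.⊖ n) ≈ ι m - ι n
  ιℤ-⊖ zero    zero    = sym (-‿inverseʳ 0#)
  ιℤ-⊖ zero    (suc n) = sym (+-identityˡ _)
  ιℤ-⊖ (suc m) zero    = sym (trans (+-congˡ ε⁻¹≈ε) (+-identityʳ _))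
  ιℤ-⊖ (suc m) (suc n) = begin
    ιℤ (suc m ℤ.⊖ suc n)          ≡⟨ ≡.cong ιℤ (ℤ.[1+m]⊖[1+n]≡m⊖n m n) ⟩
    ιℤ (m ℤ.⊖ n)                  ≈⟨ ιℤ-⊖ m n ⟩
    ι m - ι n                     ≈⟨ sym (+-identityˡ _) ⟩
    0# + (ι m - ι n)              ≈⟨ +-congʳ (sym (-‿inverseʳ 1#)) ⟩
    (1# - 1#) + (ι m - ι n)       ≈⟨ interchange _ _ _ _ ⟩
    (1# + ι m) + (- 1# - ι n)     ≈⟨ +-congˡ (⁻¹-∙-comm _ _) ⟩
    (1# + ι m) - (1# + ι n)       ∎

  ιℤ-+ : ∀ i j → ιℤ (i ℤ.+ j) ≈ ιℤ i + ιℤ j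
  ιℤ-+ -[1+ m ] -[1+ n ] = begin
    - ι (suc (suc (m ℕ.+ n)))       ≡⟨ ≡.cong (λ x → - ι (suc x)) (≡.sym (ℕ.+-suc m n)) ⟩
    - ι (suc m ℕ.+ suc n)           ≈⟨ -‿cong (ι-+ (suc m) (suc n)) ⟩
    - (ι (suc m) + ι (suc n))       ≈⟨ sym (⁻¹-∙-comm _ _) ⟩
    - ι (suc m) - ι (suc n)         ∎
  ιℤ-+ -[1+ m ] (+ n)    = trans (ιℤ-⊖ n (suc m)) (+-comm _ _)
  ιℤ-+ (+ m)    -[1+ n ] = ιℤ-⊖ m (suc n)
  ιℤ-+ (+ m)    (+ n)    = ι-+ m n

  ιℤ-*-+ : ∀ m j → ιℤ (+ m ℤ.* j) ≈ ι m * ιℤ j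
  ιℤ-*-+ m (+ n) = trans (reflexive (≡.cong ιℤ (≡.sym (ℤ.pos-* m n)))) (ι-* m n)
  ιℤ-*-+ m -[1+ n ] = begin
    ιℤ (+ m ℤ.* -[1+ n ])           ≡⟨ ≡.cong ιℤ (≡.sym (ℤ.neg-distribʳ-* (+ m) (+ suc n))) ⟩
    ιℤ (ℤ.- (+ m ℤ.* + suc n))      ≈⟨ ιℤ-neg (+ m ℤ.* + suc n) ⟩
    - ιℤ (+ m ℤ.* + suc n)          ≈⟨ -‿cong (ιℤ-*-+ m (+ suc n)) ⟩
    - (ι m * ι (suc n))             ≈⟨ -‿distribʳ-* _ _ ⟩
    ι m * - ι (suc n)               ∎

  ιℤ-* : ∀ i j → ιℤ (i ℤ.* j) ≈ ιℤ i * ιℤ j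
  ιℤ-* (+ m)    j = ιℤ-*-+ m j
  ιℤ-* -[1+ m ] j = begin
    ιℤ (-[1+ m ] ℤ.* j)             ≡⟨ ≡.cong ιℤ (≡.sym (ℤ.neg-distribˡ-* (+ suc m) j)) ⟩
    ιℤ (ℤ.- (+ suc m ℤ.* j))        ≈⟨ ιℤ-neg (+ suc m ℤ.* j) ⟩
    - ιℤ (+ suc m ℤ.* j)            ≈⟨ -‿cong (ιℤ-*-+ (suc m) j) ⟩
    - (ι (suc m) * ιℤ j)            ≈⟨ -‿distribˡ-* _ _ ⟩
    - ι (suc m) * ιℤ j              ∎

  -- Equal to ι, but literally 1# at 1 and ι n for n ≥ 2, so that the solver's constants
  -- Κ (+ 1), Κ (+ 2), Κ (+ 3) denote exactly the 1#, ι 2, ι 3 occurring in goals.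
  κℕ : ℕ → Carrier
  κℕ 0             = 0#
  κℕ 1             = 1#
  κℕ (suc (suc n)) = ι (suc (suc n))

  κ : ℤ → Carrier
  κ (+ n)     = κℕ n
  κ -[1+ n ] = - κℕ (suc n)

  κℕ≈ι : ∀ n → κℕ n ≈ ι n
  κℕ≈ι 0             = refl
  κℕ≈ι 1             = sym (+-identityʳ 1#)
  κℕ≈ι (suc (suc n)) = refl

  κ≈ιℤ : ∀ i → κ i ≈ ιℤ i
  κ≈ιℤ (+ n)     = κℕ≈ι n
  κ≈ιℤ -[1+ n ] = -‿cong (κℕ≈ι (suc n))

  κ-+ : ∀ i j → κ (i ℤ.+ j) ≈ κ i + κ j
  κ-+ i j = trans (κ≈ιℤ (i ℤ.+ j)) (trans (ιℤ-+ i j) (sym (+-cong (κ≈ιℤ i) (κ≈ιℤ j))))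

  κ-* : ∀ i j → κ (i ℤ.* j) ≈ κ i * κ j
  κ-* i j = trans (κ≈ιℤ (i ℤ.* j)) (trans (ιℤ-* i j) (sym (*-cong (κ≈ιℤ i) (κ≈ιℤ j))))

  κ-neg : ∀ i → κ (ℤ.- i) ≈ - κ i
  κ-neg i = trans (κ≈ιℤ (ℤ.- i)) (trans (ιℤ-neg i) (sym (-‿cong (κ≈ιℤ i))))

  private
    isZero : ℤ → Bool
    isZero (+ 0) = true
    isZero _     = false

    isZero-sound : ∀ i → T (isZero i) → 0# ≈ κ i
    isZero-sound (+ 0) _ = refl

    ℤ→R : Homomorphism _ _ c ℓ
    ℤ→R = record
      { from = record { rawRing = ℤ.+-*-rawRing ; isZero = isZero }
      ; to = fromCommutativeRing R (λ _ → nothing)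
      ; morphism = record
        { ⟦_⟧    = κ
        ; +-homo = κ-+
        ; *-homo = κ-*
        ; -‿homo = κ-neg
        ; 0-homo = refl
        ; 1-homo = refl
        }
      ; Zero-C⟶Zero-R = isZero-sound
      }

  open import Tactic.RingSolver.Core.Expression public using (Expr; Κ; Ι; _⊕_; _⊗_; ⊝_; _⊛_)

  private
    open import Tactic.RingSolver.Core.Expression using (module Eval)
    open Eval rawRing κ using (⟦_⟧)
    open import Tactic.RingSolver.Core.Polynomial.Base (Homomorphism.from ℤ→R)
      using (Poly; _⊞_; _⊠_; ⊟_; _⊡_) renaming (κ to κₚ; ι to ιₚ)
    open import Tactic.RingSolver.Core.Polynomial.Semantics ℤ→R renaming (⟦_⟧ to ⟦_⟧ₚ)
    open import Tactic.RingSolver.Core.Polynomial.Homomorphism ℤ→R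
    open import Algebra.Properties.Semiring.Exp.TCOptimised semiring using (^-congˡ)

    norm : ∀ {n} → Expr ℤ n → Poly n
    norm (Κ x)   = κₚ x
    norm (Ι x)   = ιₚ x
    norm (x ⊕ y) = norm x ⊞ norm y
    norm (x ⊗ y) = norm x ⊠ norm y
    norm (⊝ x)   = ⊟ norm x
    norm (x ⊛ i) = norm x ⊡ i

    ⟦_⇓⟧ : ∀ {n} → Expr ℤ n → Vec Carrier n → Carrier
    ⟦ e ⇓⟧ = ⟦ norm e ⟧ₚ

    correct : ∀ {n} (e : Expr ℤ n) ρ → ⟦ e ⇓⟧ ρ ≈ ⟦ e ⟧ ρ
    correct (Κ x)   ρ = κ-hom x ρ
    correct (Ι x)   ρ = ι-hom x ρ
    correct (x ⊕ y) ρ = trans (⊞-hom (norm x) (norm y) ρ) (+-cong (correct x ρ) (correct y ρ))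
    correct (x ⊗ y) ρ = trans (⊠-hom (norm x) (norm y) ρ) (*-cong (correct x ρ) (correct y ρ))
    correct (⊝ x)   ρ = trans (⊟-hom (norm x) ρ) (-‿cong (correct x ρ))
    correct (x ⊛ i) ρ = trans (⊡-hom (norm x) i ρ) (^-congˡ i (correct x ρ))

  open import Relation.Binary.Reflection setoid Ι ⟦_⟧ ⟦_⇓⟧ correct public using (solve)

  infix 4 _⊜_
  _⊜_ : ∀ {n} → Expr ℤ n → Expr ℤ n → Expr ℤ n × Expr ℤ n
  _⊜_ = _,_

module FallingFactorialBasis {c ℓ : Level} (R : CommutativeRing c ℓ) where
  open CommutativeRing R hiding (zero)
  open RingDefs R
  open IntegerCoefficientSolver R
  open import Relation.Binary.Reasoning.Setoid setoid

  -- C : Seq stands for Σ_m C m · x⁽ᵐ⁾; δ n is x⁽ⁿ⁾ and linMul a C is (x + a) · C.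
  Seq : Set c
  Seq = ℕ → Carrier

  infix 4 _≋_
  _≋_ : Seq → Seq → Set ℓ
  C ≋ D = ∀ m → C m ≈ D m

  δ : ℕ → Seq
  δ zero    zero    = 1#
  δ zero    (suc m) = 0#
  δ (suc n) zero    = 0#
  δ (suc n) (suc m) = δ n m

  δ-diag : ∀ n → δ n n ≡ 1#
  δ-diag zero    = ≡.refl
  δ-diag (suc n) = δ-diag n

  δ-≢ : ∀ {n m} → n ≢ m → δ n m ≡ 0#
  δ-≢ {zero}  {zero}  n≢m = ⊥-elim (n≢m ≡.refl)
  δ-≢ {zero}  {suc m} _   = ≡.refl
  δ-≢ {suc n} {zero}  _   = ≡.refl
  δ-≢ {suc n} {suc m} n≢m = δ-≢ (n≢m ∘ ≡.cong suc)

  δ-below : ∀ {n m} → m < n → δ n m ≡ 0#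
  δ-below m<n = δ-≢ (≢-sym (ℕ.<⇒≢ m<n))

  δ-above : ∀ {n m} → n < m → δ n m ≡ 0#
  δ-above n<m = δ-≢ (ℕ.<⇒≢ n<m)

  δ-weight : ∀ n m (f : ℕ → Carrier) → f m * δ n m ≈ f n * δ n m
  δ-weight zero    zero    f = refl
  δ-weight zero    (suc m) f = trans (zeroʳ _) (sym (zeroʳ _))
  δ-weight (suc n) zero    f = trans (zeroʳ _) (sym (zeroʳ _))
  δ-weight (suc n) (suc m) f = δ-weight n m (f ∘ suc)

  linMul : Carrier → Seq → Seq
  linMul a C zero    = a * C zero
  linMul a C (suc m) = C m + (ι (suc m) + a) * C (suc m)

  linMul-cong : ∀ {a b C D} → a ≈ b → C ≋ D → linMul a C ≋ linMul b D
  linMul-cong a≈b C≋D zero    = *-cong a≈b (C≋D zero)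
  linMul-cong a≈b C≋D (suc m) = +-cong (C≋D m) (*-cong (+-congˡ a≈b) (C≋D (suc m)))

  linMul-comm : ∀ a b C → linMul a (linMul b C) ≋ linMul b (linMul a C)
  linMul-comm a b C zero =
    solve 3 (λ a b x → a ⊗ (b ⊗ x) ⊜ b ⊗ (a ⊗ x)) refl a b (C 0)
  linMul-comm a b C (suc zero) =
    solve 5 (λ a b x y i → b ⊗ x ⊕ (i ⊕ a) ⊗ (x ⊕ (i ⊕ b) ⊗ y)
                         ⊜ a ⊗ x ⊕ (i ⊕ b) ⊗ (x ⊕ (i ⊕ a) ⊗ y))
      refl a b (C 0) (C 1) (ι 1)
  linMul-comm a b C (suc (suc m)) =
    solve 7 (λ a b x y w i j → (x ⊕ (i ⊕ b) ⊗ y) ⊕ (j ⊕ a) ⊗ (y ⊕ (j ⊕ b) ⊗ w)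
                             ⊜ (x ⊕ (i ⊕ a) ⊗ y) ⊕ (j ⊕ b) ⊗ (y ⊕ (j ⊕ a) ⊗ w))
      refl a b (C m) (C (suc m)) (C (suc (suc m))) (ι (suc m)) (ι (suc (suc m)))

  linMul-linear : ∀ a s C D → linMul a (λ m → C m + s * D m) ≋ λ m → linMul a C m + s * linMul a D m
  linMul-linear a s C D zero =
    solve 4 (λ a s x y → a ⊗ (x ⊕ s ⊗ y) ⊜ a ⊗ x ⊕ s ⊗ (a ⊗ y)) refl a s (C 0) (D 0)
  linMul-linear a s C D (suc m) =
    solve 7 (λ a s x y x′ y′ i → (x ⊕ s ⊗ y) ⊕ (i ⊕ a) ⊗ (x′ ⊕ s ⊗ y′)
                               ⊜ (x ⊕ (i ⊕ a) ⊗ x′) ⊕ s ⊗ (y ⊕ (i ⊕ a) ⊗ y′))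
      refl a s (C m) (D m) (C (suc m)) (D (suc m)) (ι (suc m))

  linMul-split : ∀ a C m → linMul a C m ≈ a * C m + linMul 0# C m
  linMul-split a C zero =
    solve 2 (λ a x → a ⊗ x ⊜ a ⊗ x ⊕ Κ (+ 0) ⊗ x) refl a (C 0)
  linMul-split a C (suc m) =
    solve 4 (λ a x y i → x ⊕ (i ⊕ a) ⊗ y ⊜ a ⊗ y ⊕ (x ⊕ (i ⊕ Κ (+ 0)) ⊗ y))
      refl a (C m) (C (suc m)) (ι (suc m))

  linMul-δ : ∀ a n → linMul a (δ n) ≋ λ m → δ (suc n) m + (ι n + a) * δ n m
  linMul-δ a zero    zero    = solve 1 (λ a → a ⊗ Κ (+ 1) ⊜ Κ (+ 0) ⊕ (Κ (+ 0) ⊕ a) ⊗ Κ (+ 1)) refl a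
  linMul-δ a (suc n) zero    =
    solve 2 (λ a i → a ⊗ Κ (+ 0) ⊜ Κ (+ 0) ⊕ (i ⊕ a) ⊗ Κ (+ 0)) refl a (ι (suc n))
  linMul-δ a n       (suc m) = +-congˡ (δ-weight n (suc m) (λ i → ι i + a))

  linMul-δ-root : ∀ n → linMul (- ι n) (δ n) ≋ δ (suc n)
  linMul-δ-root n m = trans (linMul-δ (- ι n) n m)
    (solve 3 (λ x i y → x ⊕ (i ⊕ ⊝ i) ⊗ y ⊜ x) refl (δ (suc n) m) (ι n) (δ n m))

  linMul²-δ : ∀ a b n → linMul a (linMul b (δ n)) ≋
    λ m → δ (2 ℕ.+ n) m + (1# + (ι n + a) + (ι n + b)) * δ (suc n) m + (ι n + a) * (ι n + b) * δ n m
  linMul²-δ a b n m = begin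
    linMul a (linMul b (δ n)) m
      ≈⟨ linMul-cong refl (linMul-δ b n) m ⟩
    linMul a (λ m → δ (suc n) m + q * δ n m) m
      ≈⟨ linMul-linear a q (δ (suc n)) (δ n) m ⟩
    linMul a (δ (suc n)) m + q * linMul a (δ n) m
      ≈⟨ +-cong (linMul-δ a (suc n) m) (*-congˡ (linMul-δ a n m)) ⟩
    δ (2 ℕ.+ n) m + (1# + ι n + a) * δ (suc n) m + q * (δ (suc n) m + p * δ n m)
      ≈⟨ solve 7 (λ d₂ d₁ d₀ i a p q → d₂ ⊕ (Κ (+ 1) ⊕ i ⊕ a) ⊗ d₁ ⊕ q ⊗ (d₁ ⊕ p ⊗ d₀)
                                      ⊜ d₂ ⊕ (Κ (+ 1) ⊕ (i ⊕ a) ⊕ q) ⊗ d₁ ⊕ p ⊗ q ⊗ d₀)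
           refl (δ (2 ℕ.+ n) m) (δ (suc n) m) (δ n m) (ι n) a p q ⟩
    δ (2 ℕ.+ n) m + (1# + (ι n + a) + q) * δ (suc n) m + p * q * δ n m ∎
    where
    p q : Carrier
    p = ι n + a
    q = ι n + b

  module _ (a b : Carrier) (n : ℕ) where
    private
      p q : Carrier
      p = ι n + a
      q = ι n + b

      at : ∀ m {d₂ d₁ d₀} → δ (2 ℕ.+ n) m ≡ d₂ → δ (suc n) m ≡ d₁ → δ n m ≡ d₀ →
           linMul a (linMul b (δ n)) m ≈ d₂ + (1# + p + q) * d₁ + p * q * d₀
      at m ≡.refl ≡.refl ≡.refl = linMul²-δ a b n m

    linMul²-δ-top : linMul a (linMul b (δ n)) (2 ℕ.+ n) ≈ 1#
    linMul²-δ-top = trans (at (2 ℕ.+ n) (δ-diag (2 ℕ.+ n)) (δ-above (ℕ.n<1+n (suc n))) (δ-above (ℕ.m<n⇒m<1+n (ℕ.n<1+n n))))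
      (solve 2 (λ c₁ c₀ → Κ (+ 1) ⊕ c₁ ⊗ Κ (+ 0) ⊕ c₀ ⊗ Κ (+ 0) ⊜ Κ (+ 1)) refl (1# + p + q) (p * q))

    linMul²-δ-next : linMul a (linMul b (δ n)) (suc n) ≈ 1# + p + q
    linMul²-δ-next = trans (at (suc n) (δ-below (ℕ.n<1+n (suc n))) (δ-diag (suc n)) (δ-above (ℕ.n<1+n n)))
      (solve 2 (λ c₁ c₀ → Κ (+ 0) ⊕ c₁ ⊗ Κ (+ 1) ⊕ c₀ ⊗ Κ (+ 0) ⊜ c₁) refl (1# + p + q) (p * q))

    linMul²-δ-base : linMul a (linMul b (δ n)) n ≈ p * q
    linMul²-δ-base = trans (at n (δ-below (ℕ.m<n⇒m<1+n (ℕ.n<1+n n))) (δ-below (ℕ.n<1+n n)) (δ-diag n))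
      (solve 2 (λ c₁ c₀ → Κ (+ 0) ⊕ c₁ ⊗ Κ (+ 0) ⊕ c₀ ⊗ Κ (+ 1) ⊜ c₀) refl (1# + p + q) (p * q))

    linMul²-δ-below : ∀ {m} → m < n → linMul a (linMul b (δ n)) m ≈ 0#
    linMul²-δ-below m<n = trans (at _ (δ-below (ℕ.m<n⇒m<1+n (ℕ.m<n⇒m<1+n m<n))) (δ-below (ℕ.m<n⇒m<1+n m<n)) (δ-below m<n))
      (solve 2 (λ c₁ c₀ → Κ (+ 0) ⊕ c₁ ⊗ Κ (+ 0) ⊕ c₀ ⊗ Κ (+ 0) ⊜ Κ (+ 0)) refl (1# + p + q) (p * q))

  prod : (ℕ → Carrier) → ℕ → Seq → Seq
  prod g n C = foldr linMul C (applyUpTo g n)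

  prod-cong : ∀ n {g h C D} → (∀ i → i < n → g i ≈ h i) → C ≋ D → prod g n C ≋ prod h n D
  prod-cong zero    g≈h C≋D = C≋D
  prod-cong (suc n) g≈h C≋D =
    linMul-cong (g≈h 0 (s≤s z≤n)) (prod-cong n (λ i i<n → g≈h (suc i) (s≤s i<n)) C≋D)

  prod-linMul : ∀ n g a C → prod g n (linMul a C) ≋ linMul a (prod g n C)
  prod-linMul zero    g a C m = refl
  prod-linMul (suc n) g a C m =
    trans (linMul-cong refl (prod-linMul n (g ∘ suc) a C) m) (linMul-comm (g 0) a _ m)

  prod-+ : ∀ m n g C → prod g (m ℕ.+ n) C ≡ prod g m (prod (λ i → g (m ℕ.+ i)) n C)
  prod-+ zero    n g C = ≡.refl
  prod-+ (suc m) n g C = ≡.cong (linMul (g 0)) (prod-+ m n (g ∘ suc) C)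

  prod-snoc : ∀ n g C → prod g (suc n) C ≋ linMul (g n) (prod g n C)
  prod-snoc zero    g C m = refl
  prod-snoc (suc n) g C m = begin
    linMul (g 0) (prod (g ∘ suc) (suc n) C) m              ≈⟨ linMul-cong refl (prod-snoc n (g ∘ suc) C) m ⟩
    linMul (g 0) (linMul (g (suc n)) (prod (g ∘ suc) n C)) m ≈⟨ linMul-comm _ _ _ m ⟩
    linMul (g (suc n)) (prod g (suc n) C) m                 ∎

  prod-evens-odds : ∀ n →
    prod (λ i → - ι (2 ℕ.* i)) n (prod (λ i → - ι (suc (2 ℕ.* (n ∸ suc i)))) n (δ 0)) ≋ δ (2 ℕ.* n)
  prod-evens-odds zero    m = refl
  prod-evens-odds (suc n) m = begin
    prod even (suc n) (linMul (odd n) (oddsDown n)) m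
      ≈⟨ prod-snoc n even _ m ⟩
    linMul (even n) (prod even n (linMul (odd n) (oddsDown n))) m
      ≈⟨ linMul-cong refl (prod-linMul n even (odd n) _) m ⟩
    linMul (even n) (linMul (odd n) (prod even n (oddsDown n))) m
      ≈⟨ linMul-cong refl (linMul-cong refl (prod-evens-odds n)) m ⟩
    linMul (even n) (linMul (odd n) (δ (2 ℕ.* n))) m
      ≈⟨ linMul-comm _ _ _ m ⟩
    linMul (odd n) (linMul (even n) (δ (2 ℕ.* n))) m
      ≈⟨ linMul-cong refl (linMul-δ-root (2 ℕ.* n)) m ⟩
    linMul (odd n) (δ (suc (2 ℕ.* n))) m
      ≈⟨ linMul-δ-root (suc (2 ℕ.* n)) m ⟩
    δ (suc (suc (2 ℕ.* n))) m
      ≡⟨ ≡.cong (λ d → δ d m) (≡.sym (ℕ.*-suc 2 n)) ⟩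
    δ (2 ℕ.* suc n) m ∎
    where
    even odd : ℕ → Carrier
    even i = - ι (2 ℕ.* i)
    odd  i = - ι (suc (2 ℕ.* i))
    oddsDown : ℕ → Seq
    oddsDown n = prod (λ i → odd (n ∸ suc i)) n (δ 0)

S-vanish : ∀ {n m} → n < m → S n m ≡ 0
S-vanish {zero}  {suc m} _ = ≡.refl
S-vanish {suc n} {suc m} (s≤s n<m) =
  ≡.trans (≡.cong₂ (λ a b → suc m ℕ.* a ℕ.+ b) (S-vanish (ℕ.m<n⇒m<1+n n<m)) (S-vanish n<m))
          (≡.trans (ℕ.+-identityʳ _) (ℕ.*-zeroʳ (suc m)))

module StirlingExpansion {c ℓ : Level} (R : CommutativeRing c ℓ) where
  open CommutativeRing R hiding (zero)
  open RingDefs R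
  open IntegerCoefficientSolver R
  open FallingFactorialBasis R
  open import Algebra.Properties.CommutativeSemigroup +-commutativeSemigroup using (interchange)
  open import Relation.Binary.Reasoning.Setoid setoid

  sumTo-cong : ∀ n {f g} → (∀ j → j ≤ n → f j ≈ g j) → sumTo n f ≈ sumTo n g
  sumTo-cong zero    f≈g = f≈g 0 z≤n
  sumTo-cong (suc n) f≈g =
    +-cong (sumTo-cong n (λ j j≤n → f≈g j (ℕ.m≤n⇒m≤1+n j≤n))) (f≈g (suc n) ℕ.≤-refl)

  sumTo-+ : ∀ n f g → sumTo n (λ j → f j + g j) ≈ sumTo n f + sumTo n g
  sumTo-+ zero    f g = refl
  sumTo-+ (suc n) f g = trans (+-congʳ (sumTo-+ n f g)) (interchange _ _ _ _)

  sumTo-*ˡ : ∀ n a f → sumTo n (λ j → a * f j) ≈ a * sumTo n f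
  sumTo-*ˡ zero    a f = refl
  sumTo-*ˡ (suc n) a f = trans (+-congʳ (sumTo-*ˡ n a f)) (sym (distribˡ _ _ _))

  sumTo-zero : ∀ n → sumTo n (λ _ → 0#) ≈ 0#
  sumTo-zero zero    = refl
  sumTo-zero (suc n) = trans (+-identityʳ _) (sumTo-zero n)

  sumTo-unfoldˡ : ∀ n f → sumTo (suc n) f ≈ f 0 + sumTo n (f ∘ suc)
  sumTo-unfoldˡ zero    f = refl
  sumTo-unfoldˡ (suc n) f = trans (+-congʳ (sumTo-unfoldˡ n f)) (+-assoc _ _ _)

  sumTo-truncate : ∀ {a} n f → a ≤ n → (∀ j → a < j → f j ≈ 0#) → sumTo n f ≈ sumTo a f
  sumTo-truncate zero    f z≤n _ = refl
  sumTo-truncate (suc n) f a≤1+n f≈0 with ℕ.m≤n⇒m<n∨m≡n a≤1+n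
  ... | inj₂ ≡.refl = refl
  ... | inj₁ (s≤s a≤n) =
    trans (+-cong (sumTo-truncate n f a≤n f≈0) (f≈0 (suc n) (s≤s a≤n))) (+-identityʳ _)

  e-map-* : ∀ s l xs → e l (map (s *_) xs) ≈ pow s l * e l xs
  e-map-* s zero    xs       = sym (*-identityˡ _)
  e-map-* s (suc l) []       = sym (zeroʳ _)
  e-map-* s (suc l) (x ∷ xs) = begin
    s * x * e l (map (s *_) xs) + e (suc l) (map (s *_) xs)
      ≈⟨ +-cong (*-congˡ (e-map-* s l xs)) (e-map-* s (suc l) xs) ⟩
    s * x * (pow s l * e l xs) + s * pow s l * e (suc l) xs
      ≈⟨ solve 5 (λ s x p a b → s ⊗ x ⊗ (p ⊗ a) ⊕ s ⊗ p ⊗ b ⊜ s ⊗ p ⊗ (x ⊗ a ⊕ b))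
           refl s x (pow s l) (e l xs) (e (suc l) xs) ⟩
    s * pow s l * (x * e l xs + e (suc l) xs) ∎

  e-vanish : ∀ l xs → length xs < l → e l xs ≈ 0#
  e-vanish (suc l)       []       _          = refl
  e-vanish (suc (suc l)) (x ∷ xs) (s≤s l<xs) =
    trans (+-cong (*-congˡ (e-vanish (suc l) xs l<xs)) (e-vanish (suc (suc l)) xs (ℕ.m<n⇒m<1+n l<xs)))
      (trans (+-congʳ (zeroʳ _)) (+-identityʳ _))

  stirlingCoeffs : List Carrier → ℕ → Seq
  stirlingCoeffs y n m = sumTo n (λ j → e j y * ι (S (n ∸ j) m))

  stirlingCoeffs-∷ : ∀ y₀ y n m →
    stirlingCoeffs (y₀ ∷ y) (suc n) m ≈ y₀ * stirlingCoeffs y n m + stirlingCoeffs y (suc n) m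
  stirlingCoeffs-∷ y₀ y n m = begin
    stirlingCoeffs (y₀ ∷ y) (suc n) m
      ≈⟨ sumTo-unfoldˡ n _ ⟩
    S₀ + sumTo n (λ j → (y₀ * e j y + e (suc j) y) * ι (S (n ∸ j) m))
      ≈⟨ +-congˡ (sumTo-cong n (λ j _ → solve 4 (λ y₀ a b s → (y₀ ⊗ a ⊕ b) ⊗ s ⊜ y₀ ⊗ (a ⊗ s) ⊕ b ⊗ s)
                                                  refl y₀ (e j y) (e (suc j) y) (ι (S (n ∸ j) m)))) ⟩
    S₀ + sumTo n (λ j → y₀ * (e j y * ι (S (n ∸ j) m)) + e (suc j) y * ι (S (n ∸ j) m))
      ≈⟨ +-congˡ (trans (sumTo-+ n _ _) (+-congʳ (sumTo-*ˡ n y₀ _))) ⟩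
    S₀ + (y₀ * stirlingCoeffs y n m + sumTo n (λ j → e (suc j) y * ι (S (n ∸ j) m)))
      ≈⟨ solve 3 (λ a b c → a ⊕ (b ⊕ c) ⊜ b ⊕ (a ⊕ c)) refl S₀ _ _ ⟩
    y₀ * stirlingCoeffs y n m + (S₀ + sumTo n (λ j → e (suc j) y * ι (S (n ∸ j) m)))
      ≈⟨ +-congˡ (sym (sumTo-unfoldˡ n _)) ⟩
    y₀ * stirlingCoeffs y n m + stirlingCoeffs y (suc n) m ∎
    where
    S₀ : Carrier
    S₀ = 1# * ι (S (suc n) m)

  ι-S-suc : ∀ n m → ι (S (suc n) (suc m)) ≈ ι (suc m) * ι (S n (suc m)) + ι (S n m)
  ι-S-suc n m = trans (ι-+ (suc m ℕ.* S n (suc m)) (S n m)) (+-congʳ (ι-* (suc m) (S n (suc m))))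

  stirlingCoeffs-suc : ∀ y n → e (suc n) y ≈ 0# → stirlingCoeffs y (suc n) ≋ linMul 0# (stirlingCoeffs y n)
  stirlingCoeffs-suc y n e≈0 m = begin
    stirlingCoeffs y (suc n) m
      ≈⟨ +-congˡ (trans (*-congʳ e≈0) (zeroˡ _)) ⟩
    sumTo n (λ j → e j y * ι (S (suc n ∸ j) m)) + 0#
      ≈⟨ +-identityʳ _ ⟩
    sumTo n (λ j → e j y * ι (S (suc n ∸ j) m))
      ≈⟨ sumTo-cong n (λ j j≤n → reflexive (≡.cong (λ i → e j y * ι (S i m)) (ℕ.+-∸-assoc 1 j≤n))) ⟩
    sumTo n (λ j → e j y * ι (S (suc (n ∸ j)) m))
      ≈⟨ step m ⟩
    linMul 0# (stirlingCoeffs y n) m ∎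
    where
    step : ∀ m → sumTo n (λ j → e j y * ι (S (suc (n ∸ j)) m)) ≈ linMul 0# (stirlingCoeffs y n) m
    step zero    = trans (trans (sumTo-cong n (λ _ _ → zeroʳ _)) (sumTo-zero n)) (sym (zeroˡ _))
    step (suc m) = begin
      sumTo n (λ j → e j y * ι (S (suc (n ∸ j)) (suc m)))
        ≈⟨ sumTo-cong n (λ j _ → trans (*-congˡ (ι-S-suc (n ∸ j) m))
             (solve 4 (λ a i s t → a ⊗ (i ⊗ s ⊕ t) ⊜ i ⊗ (a ⊗ s) ⊕ a ⊗ t)
               refl (e j y) (ι (suc m)) (ι (S (n ∸ j) (suc m))) (ι (S (n ∸ j) m)))) ⟩
      sumTo n (λ j → ι (suc m) * (e j y * ι (S (n ∸ j) (suc m))) + e j y * ι (S (n ∸ j) m))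
        ≈⟨ trans (sumTo-+ n _ _) (+-congʳ (sumTo-*ˡ n (ι (suc m)) _)) ⟩
      ι (suc m) * C (suc m) + C m
        ≈⟨ solve 3 (λ i x y → i ⊗ y ⊕ x ⊜ x ⊕ (i ⊕ Κ (+ 0)) ⊗ y) refl (ι (suc m)) (C m) (C (suc m)) ⟩
      linMul 0# C (suc m) ∎
      where
      C : Seq
      C = stirlingCoeffs y n

  stirlingCoeffs-foldr : ∀ y → stirlingCoeffs y (length y) ≋ foldr linMul (δ 0) y
  stirlingCoeffs-foldr []       zero    = solve 0 (Κ (+ 1) ⊗ (Κ (+ 1) ⊕ Κ (+ 0)) ⊜ Κ (+ 1)) refl
  stirlingCoeffs-foldr []       (suc m) = zeroʳ 1#
  stirlingCoeffs-foldr (y₀ ∷ y) m = begin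
    stirlingCoeffs (y₀ ∷ y) (suc n) m
      ≈⟨ stirlingCoeffs-∷ y₀ y n m ⟩
    y₀ * stirlingCoeffs y n m + stirlingCoeffs y (suc n) m
      ≈⟨ +-congˡ (stirlingCoeffs-suc y n (e-vanish (suc n) y ℕ.≤-refl) m) ⟩
    y₀ * stirlingCoeffs y n m + linMul 0# (stirlingCoeffs y n) m
      ≈⟨ sym (linMul-split y₀ (stirlingCoeffs y n) m) ⟩
    linMul y₀ (stirlingCoeffs y n) m
      ≈⟨ linMul-cong refl (stirlingCoeffs-foldr y) m ⟩
    foldr linMul (δ 0) (y₀ ∷ y) m ∎
    where
    n : ℕ
    n = length y

  stirling-expansion : ∀ s xs N m → length xs ≡ N → .{{NonZero m}} →
    sumTo (N ∸ m) (λ j → pow s j * e j xs * ι (S (N ∸ j) m)) ≈ foldr linMul (δ 0) (map (s *_) xs) m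
  stirling-expansion s xs N m ∣xs∣≡N = begin
    sumTo (N ∸ m) (λ j → pow s j * e j xs * ι (S (N ∸ j) m))
      ≈⟨ sumTo-cong (N ∸ m) (λ j _ → *-congʳ (sym (e-map-* s j xs))) ⟩
    sumTo (N ∸ m) f
      ≈⟨ sym (sumTo-truncate N f (ℕ.m∸n≤m N m) f≈0) ⟩
    stirlingCoeffs ys N m
      ≡⟨ ≡.cong (λ n → stirlingCoeffs ys n m) (≡.trans (≡.sym ∣xs∣≡N) (≡.sym (length-map (s *_) xs))) ⟩
    stirlingCoeffs ys (length ys) m
      ≈⟨ stirlingCoeffs-foldr ys m ⟩
    foldr linMul (δ 0) ys m ∎
    where
    ys : List Carrier
    ys = map (s *_) xs
    f : ℕ → Carrier
    f j = e j ys * ι (S (N ∸ j) m)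
    f≈0 : ∀ j → N ∸ m < j → f j ≈ 0#
    f≈0 j N∸m<j = trans (*-congˡ (reflexive (≡.cong ι (S-vanish N∸j<m)))) (zeroʳ _)
      where
      N∸j<m : N ∸ j < m
      N∸j<m = ℕ.m<n+o⇒m∸n<o N j (ℕ.<-≤-trans (ℕ.≤-<-trans (ℕ.m≤n+m∸n N m) (ℕ.+-monoʳ-< m N∸m<j))
                                              (ℕ.≤-reflexive (ℕ.+-comm m j)))

module IndexArithmetic where
  open import Data.Nat.Tactic.RingSolver using (solve-∀)
  open ≡.≡-Reasoning

  private
    double-suc : ∀ t i → 2 ℕ.* suc (t ℕ.+ suc i ℕ.+ suc i) ≡ 2 ℕ.* t ℕ.+ 4 ℕ.* i ℕ.+ 3 ℕ.+ 3
    double-suc = solve-∀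

    quadruple : ∀ t i → 2 ℕ.* t ℕ.+ 4 ℕ.* i ℕ.+ 3 ℕ.+ suc (2 ℕ.* t) ≡ 2 ℕ.* (t ℕ.+ suc i) ℕ.* 2
    quadruple = solve-∀

  split-2+2k : ∀ k → 2 ℕ.+ 2 ℕ.* k ≡ k ℕ.+ suc (k ℕ.+ 1)
  split-2+2k = solve-∀

  high-index : ∀ k i → i < k → 2 ℕ.* suc (k ℕ.+ suc i) ∸ 3 ℕ.+ suc (2 ℕ.* (k ∸ suc i)) ≡ 2 ℕ.* k ℕ.* 2
  high-index k i i<k with k ∸ suc i | ℕ.m∸n+n≡m i<k
  ... | t | ≡.refl = begin
    2 ℕ.* suc (t ℕ.+ suc i ℕ.+ suc i) ∸ 3 ℕ.+ suc (2 ℕ.* t)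
      ≡⟨ ≡.cong (λ x → x ∸ 3 ℕ.+ suc (2 ℕ.* t)) (double-suc t i) ⟩
    2 ℕ.* t ℕ.+ 4 ℕ.* i ℕ.+ 3 ℕ.+ 3 ∸ 3 ℕ.+ suc (2 ℕ.* t)
      ≡⟨ ≡.cong (ℕ._+ suc (2 ℕ.* t)) (ℕ.m+n∸n≡m _ 3) ⟩
    2 ℕ.* t ℕ.+ 4 ℕ.* i ℕ.+ 3 ℕ.+ suc (2 ℕ.* t)
      ≡⟨ quadruple t i ⟩
    2 ℕ.* (t ℕ.+ suc i) ℕ.* 2 ∎

if-T : ∀ {a} {A : Set a} {c : Bool} {x y : A} → T c → (if c then x else y) ≡ x
if-T {c = true} _ = ≡.refl

if-¬T : ∀ {a} {A : Set a} {c : Bool} {x y : A} → ¬ T c → (if c then x else y) ≡ y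
if-¬T {c = false} _   = ≡.refl
if-¬T {c = true}  ¬tt = ⊥-elim (¬tt tt)

n<m⇒¬T[m≤ᵇn] : ∀ {m n} → n < m → ¬ T (m ≤ᵇ n)
n<m⇒¬T[m≤ᵇn] n<m = ℕ.<⇒≱ n<m ∘ ℕ.≤ᵇ⇒≤ _ _

m≢n⇒¬T[m≡ᵇn] : ∀ {m n} → m ≢ n → ¬ T (m ≡ᵇ n)
m≢n⇒¬T[m≡ᵇn] m≢n = m≢n ∘ ℕ.≡ᵇ⇒≡ _ _

module ScaledMultiset {c ℓ : Level} (R : CommutativeRing c ℓ) where
  open CommutativeRing R
  open RingDefs R
  open IntegerCoefficientSolver R
  open FallingFactorialBasis R
  open StirlingExpansion R
  open IndexArithmetic
  open import Relation.Binary.Reasoning.Setoid setoid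

  module Roots (k : ℕ) (z ik i2 : Carrier) (k·ik≈1 : ι k * ik ≈ 1#) (2·i2≈1 : ι 2 * i2 ≈ 1#) where

    β : ℕ → Carrier
    β = b k z ik i2

    β-low : ∀ {j} → j ≤ k → β j ≡ ι (j ∸ 1) * ik
    β-low j≤k = if-T (ℕ.≤⇒≤ᵇ j≤k)

    β-mid : β (suc k) ≡ i2 - (1# + z) * (i2 * ik)
    β-mid = ≡.trans (if-¬T (n<m⇒¬T[m≤ᵇn] (ℕ.n<1+n k))) (if-T (ℕ.≡⇒≡ᵇ (suc k) (suc k) ≡.refl))

    β-high : ∀ {j} → suc k < j → j ≤ suc (2 ℕ.* k) → β j ≡ ι 2 - ι (2 ℕ.* j ∸ 3) * (i2 * ik)
    β-high k+1<j j≤2k+1 = ≡.trans (if-¬T (n<m⇒¬T[m≤ᵇn] (ℕ.<-trans (ℕ.n<1+n k) k+1<j)))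
      (≡.trans (if-¬T (m≢n⇒¬T[m≡ᵇn] (≢-sym (ℕ.<⇒≢ k+1<j)))) (if-T (ℕ.≤⇒≤ᵇ j≤2k+1)))

    β-top : β (2 ℕ.+ 2 ℕ.* k) ≡ 1# - (1# + z) * (i2 * ik)
    β-top = ≡.trans (if-¬T (n<m⇒¬T[m≤ᵇn] (ℕ.m<n⇒m<1+n k<2k+1)))
      (≡.trans (if-¬T (m≢n⇒¬T[m≡ᵇn] (≢-sym (ℕ.<⇒≢ (s≤s k<2k+1)))))
        (if-¬T (n<m⇒¬T[m≤ᵇn] (ℕ.n<1+n (suc (2 ℕ.* k))))))
      where
      k<2k+1 : k < suc (2 ℕ.* k)
      k<2k+1 = s≤s (ℕ.m≤m+n k _)

    s : Carrier
    s = - ι (2 ℕ.* k)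

    root : ℕ → Carrier
    root i = s * β (suc i)

    2k·ik≈2 : ι (2 ℕ.* k) * ik ≈ ι 2
    2k·ik≈2 = begin
      ι (2 ℕ.* k) * ik ≈⟨ *-congʳ (ι-* 2 k) ⟩
      ι 2 * ι k * ik   ≈⟨ *-assoc _ _ _ ⟩
      ι 2 * (ι k * ik) ≈⟨ *-congˡ k·ik≈1 ⟩
      ι 2 * 1#         ≈⟨ *-identityʳ _ ⟩
      ι 2              ∎

    2k·i2≈k : ι (2 ℕ.* k) * i2 ≈ ι k
    2k·i2≈k = begin
      ι (2 ℕ.* k) * i2 ≈⟨ *-congʳ (ι-* 2 k) ⟩
      ι 2 * ι k * i2   ≈⟨ solve 3 (λ t x h → t ⊗ x ⊗ h ⊜ x ⊗ (t ⊗ h)) refl (ι 2) (ι k) i2 ⟩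
      ι k * (ι 2 * i2) ≈⟨ *-congˡ 2·i2≈1 ⟩
      ι k * 1#         ≈⟨ *-identityʳ _ ⟩
      ι k              ∎

    2k·i2·ik≈1 : ι (2 ℕ.* k) * (i2 * ik) ≈ 1#
    2k·i2·ik≈1 = begin
      ι (2 ℕ.* k) * (i2 * ik)   ≈⟨ *-congʳ (ι-* 2 k) ⟩
      ι 2 * ι k * (i2 * ik)     ≈⟨ solve 4 (λ t x h y → t ⊗ x ⊗ (h ⊗ y) ⊜ (t ⊗ h) ⊗ (x ⊗ y)) refl (ι 2) (ι k) i2 ik ⟩
      (ι 2 * i2) * (ι k * ik)   ≈⟨ *-cong 2·i2≈1 k·ik≈1 ⟩
      1# * 1#                   ≈⟨ *-identityˡ _ ⟩
      1#                        ∎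

    s-scale : ∀ p w → s * (p - w * (i2 * ik)) ≈ w - ι (2 ℕ.* k) * p
    s-scale p w = begin
      s * (p - w * (i2 * ik))
        ≈⟨ solve 4 (λ K p w u → ⊝ K ⊗ (p ⊕ ⊝ (w ⊗ u)) ⊜ w ⊗ (K ⊗ u) ⊕ ⊝ (K ⊗ p)) refl (ι (2 ℕ.* k)) p w (i2 * ik) ⟩
      w * (ι (2 ℕ.* k) * (i2 * ik)) - ι (2 ℕ.* k) * p
        ≈⟨ +-congʳ (trans (*-congˡ 2k·i2·ik≈1) (*-identityʳ w)) ⟩
      w - ι (2 ℕ.* k) * p ∎

    root-low : ∀ {i} → i < k → root i ≈ - ι (2 ℕ.* i)
    root-low {i} i<k = begin
      s * β (suc i)                 ≡⟨ ≡.cong (s *_) (β-low i<k) ⟩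
      s * (ι i * ik)                ≈⟨ solve 3 (λ K x y → ⊝ K ⊗ (x ⊗ y) ⊜ ⊝ (K ⊗ y ⊗ x)) refl (ι (2 ℕ.* k)) (ι i) ik ⟩
      - (ι (2 ℕ.* k) * ik * ι i)    ≈⟨ -‿cong (trans (*-congʳ 2k·ik≈2) (sym (ι-* 2 i))) ⟩
      - ι (2 ℕ.* i)                 ∎

    root-high : ∀ {i} → i < k → root (k ℕ.+ suc i) ≈ - ι (suc (2 ℕ.* (k ∸ suc i)))
    root-high {i} i<k = begin
      s * β j                              ≡⟨ ≡.cong (s *_) (β-high k+1<j j≤2k+1) ⟩
      s * (ι 2 - ι a * (i2 * ik))          ≈⟨ s-scale (ι 2) (ι a) ⟩
      ι a - ι (2 ℕ.* k) * ι 2              ≈⟨ +-congˡ (-‿cong (trans (sym (ι-* (2 ℕ.* k) 2))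
                                                (trans (reflexive (≡.cong ι (≡.sym (high-index k i i<k)))) (ι-+ a o)))) ⟩
      ι a - (ι a + ι o)                    ≈⟨ solve 2 (λ x y → x ⊕ ⊝ (x ⊕ y) ⊜ ⊝ y) refl (ι a) (ι o) ⟩
      - ι o                                ∎
      where
      j a o : ℕ
      j = suc (k ℕ.+ suc i)
      a = 2 ℕ.* j ∸ 3
      o = suc (2 ℕ.* (k ∸ suc i))
      k+1<j : suc k < j
      k+1<j = s≤s (ℕ.≤-trans (s≤s (ℕ.m≤m+n k i)) (ℕ.≤-reflexive (≡.sym (ℕ.+-suc k i))))
      j≤2k+1 : j ≤ suc (2 ℕ.* k)
      j≤2k+1 = s≤s (ℕ.+-monoʳ-≤ k (ℕ.≤-trans i<k (ℕ.≤-reflexive (≡.sym (ℕ.+-identityʳ k)))))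

    root-mid : ι (2 ℕ.* k) + root k ≈ z + ι k + 1#
    root-mid = begin
      ι (2 ℕ.* k) + s * β (suc k)                 ≡⟨ ≡.cong (λ x → ι (2 ℕ.* k) + s * x) β-mid ⟩
      ι (2 ℕ.* k) + s * (i2 - (1# + z) * (i2 * ik)) ≈⟨ +-cong (ι-* 2 k) (s-scale i2 (1# + z)) ⟩
      ι 2 * ι k + ((1# + z) - ι (2 ℕ.* k) * i2)    ≈⟨ +-congˡ (+-congˡ (-‿cong 2k·i2≈k)) ⟩
      ι 2 * ι k + ((1# + z) - ι k)                 ≈⟨ solve 2 (λ x z → Κ (+ 2) ⊗ x ⊕ ((Κ (+ 1) ⊕ z) ⊕ ⊝ x) ⊜ z ⊕ x ⊕ Κ (+ 1)) refl (ι k) z ⟩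
      z + ι k + 1#                                 ∎

    root-top : ι (2 ℕ.* k) + root (suc (2 ℕ.* k)) ≈ z + 1#
    root-top = begin
      ι (2 ℕ.* k) + s * β (2 ℕ.+ 2 ℕ.* k)          ≡⟨ ≡.cong (λ x → ι (2 ℕ.* k) + s * x) β-top ⟩
      ι (2 ℕ.* k) + s * (1# - (1# + z) * (i2 * ik)) ≈⟨ +-congˡ (s-scale 1# (1# + z)) ⟩
      ι (2 ℕ.* k) + ((1# + z) - ι (2 ℕ.* k) * 1#)   ≈⟨ solve 2 (λ K z → K ⊕ ((Κ (+ 1) ⊕ z) ⊕ ⊝ (K ⊗ Κ (+ 1))) ⊜ z ⊕ Κ (+ 1)) refl (ι (2 ℕ.* k)) z ⟩
      z + 1#                                        ∎

    N : ℕ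
    N = 2 ℕ.+ 2 ℕ.* k

    LHS≈prod : ∀ m → .{{NonZero m}} → LHS k z ik i2 m ≈ prod root N (δ 0) m
    LHS≈prod m = begin
      LHS k z ik i2 m                                ≈⟨ stirling-expansion s xs N m ∣X∣≡N ⟩
      foldr linMul (δ 0) (map (s *_) xs) m            ≡⟨ ≡.cong (λ ys → foldr linMul (δ 0) ys m) map-X ⟩
      prod root N (δ 0) m                            ∎
      where
      xs : List Carrier
      xs = X k z ik i2
      ∣X∣≡N : length xs ≡ N
      ∣X∣≡N = ≡.trans (length-map _ (upTo N)) (length-upTo N)
      map-X : map (s *_) xs ≡ applyUpTo root N
      map-X = ≡.trans (≡.sym (map-∘ (upTo N))) (map-upTo root N)

    prod-roots : prod root N (δ 0) ≋ linMul (root k) (linMul (root (suc (2 ℕ.* k))) (δ (2 ℕ.* k)))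
    prod-roots m = begin
      prod root N (δ 0) m
        -- the factor blocks are b_1 … b_k, b_{k+1}, b_{k+2} … b_{2k+1} and b_{2k+2}
        ≡⟨ ≡.cong (λ n → prod root n (δ 0) m) (split-2+2k k) ⟩
      prod root (k ℕ.+ suc (k ℕ.+ 1)) (δ 0) m
        ≡⟨ ≡.cong (λ C → C m) (≡.trans (prod-+ k (suc (k ℕ.+ 1)) root (δ 0))
              (≡.cong (λ C → prod root k (linMul rA C)) (prod-+ k 1 high (δ 0)))) ⟩
      prod root k (linMul rA (prod high k (linMul rB (δ 0)))) m
        ≈⟨ prod-cong k (λ _ _ → refl) (linMul-cong refl (prod-linMul k high rB (δ 0))) m ⟩
      prod root k (linMul rA (linMul rB (prod high k (δ 0)))) m
        ≈⟨ prod-linMul k root rA _ m ⟩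
      linMul rA (prod root k (linMul rB (prod high k (δ 0)))) m
        ≈⟨ linMul-cong refl (prod-linMul k root rB _) m ⟩
      linMul rA (linMul rB (prod root k (prod high k (δ 0)))) m
        ≈⟨ linMul-cong rA≈ (linMul-cong rB≈ factorial) m ⟩
      linMul (root k) (linMul (root (suc (2 ℕ.* k))) (δ (2 ℕ.* k))) m ∎
      where
      high : ℕ → Carrier
      high i = root (k ℕ.+ suc i)
      rA rB : Carrier
      rA = root (k ℕ.+ 0)
      rB = root (k ℕ.+ suc (k ℕ.+ 0))
      rA≈ : rA ≈ root k
      rA≈ = reflexive (≡.cong root (ℕ.+-identityʳ k))
      rB≈ : rB ≈ root (suc (2 ℕ.* k))
      rB≈ = reflexive (≡.cong root (ℕ.+-suc k (k ℕ.+ 0)))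
      factorial : prod root k (prod high k (δ 0)) ≋ δ (2 ℕ.* k)
      factorial m = trans (prod-cong k (λ _ → root-low) (prod-cong k (λ _ → root-high) (λ _ → refl)) m)
                          (prod-evens-odds k m)

lemma4p6 : {c ℓ : Level} (R : CommutativeRing c ℓ) →
  let open CommutativeRing R
      open RingDefs R
  in (k : ℕ) → 1 ≤ k → (z ik i2 : Carrier) →
     ι k * ik ≈ 1# → ι 2 * i2 ≈ 1# →
     (LHS k z ik i2 (2 Data.Nat.+ 2 Data.Nat.* k) ≈ 1#)
     × (LHS k z ik i2 (1 Data.Nat.+ 2 Data.Nat.* k) ≈ ι 2 * z + ι k + ι 3)
     × (LHS k z ik i2 (2 Data.Nat.* k) ≈ (z + 1#) * (z + ι k + 1#))
     × ((m : ℕ) → 1 ≤ m → m ≤ 2 Data.Nat.* k ∸ 1 → LHS k z ik i2 m ≈ 0#)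
lemma4p6 R k 1≤k z ik i2 k·ik≈1 2·i2≈1 = top , next , base , below
  where
  open CommutativeRing R
  open RingDefs R
  open IntegerCoefficientSolver R
  open FallingFactorialBasis R
  open ScaledMultiset R
  open Roots k z ik i2 k·ik≈1 2·i2≈1
  open import Relation.Binary.Reasoning.Setoid setoid

  y₁ y₂ : Carrier
  y₁ = root k
  y₂ = root (suc (2 ℕ.* k))

  LHS≈ : ∀ m → .{{NonZero m}} → LHS k z ik i2 m ≈ linMul y₁ (linMul y₂ (δ (2 ℕ.* k))) m
  LHS≈ m = trans (LHS≈prod m) (prod-roots m)

  1≤2k : 1 ≤ 2 ℕ.* k
  1≤2k = ℕ.≤-trans 1≤k (ℕ.m≤m+n k _)

  top : LHS k z ik i2 (2 ℕ.+ 2 ℕ.* k) ≈ 1#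
  top = trans (LHS≈ _) (linMul²-δ-top y₁ y₂ (2 ℕ.* k))

  next : LHS k z ik i2 (1 ℕ.+ 2 ℕ.* k) ≈ ι 2 * z + ι k + ι 3
  next = begin
    LHS k z ik i2 (1 ℕ.+ 2 ℕ.* k)                      ≈⟨ LHS≈ _ ⟩
    linMul y₁ (linMul y₂ (δ (2 ℕ.* k))) (1 ℕ.+ 2 ℕ.* k) ≈⟨ linMul²-δ-next y₁ y₂ (2 ℕ.* k) ⟩
    1# + (ι (2 ℕ.* k) + y₁) + (ι (2 ℕ.* k) + y₂)        ≈⟨ +-cong (+-congˡ root-mid) root-top ⟩
    1# + (z + ι k + 1#) + (z + 1#)
      ≈⟨ solve 2 (λ x z → Κ (+ 1) ⊕ (z ⊕ x ⊕ Κ (+ 1)) ⊕ (z ⊕ Κ (+ 1)) ⊜ Κ (+ 2) ⊗ z ⊕ x ⊕ Κ (+ 3)) refl (ι k) z ⟩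
    ι 2 * z + ι k + ι 3                                 ∎

  base : LHS k z ik i2 (2 ℕ.* k) ≈ (z + 1#) * (z + ι k + 1#)
  base = begin
    LHS k z ik i2 (2 ℕ.* k)                      ≈⟨ LHS≈ (2 ℕ.* k) {{ℕ.>-nonZero 1≤2k}} ⟩
    linMul y₁ (linMul y₂ (δ (2 ℕ.* k))) (2 ℕ.* k) ≈⟨ linMul²-δ-base y₁ y₂ (2 ℕ.* k) ⟩
    (ι (2 ℕ.* k) + y₁) * (ι (2 ℕ.* k) + y₂)       ≈⟨ *-cong root-mid root-top ⟩
    (z + ι k + 1#) * (z + 1#)                     ≈⟨ *-comm _ _ ⟩
    (z + 1#) * (z + ι k + 1#)                     ∎

  below : (m : ℕ) → 1 ≤ m → m ≤ 2 ℕ.* k ∸ 1 → LHS k z ik i2 m ≈ 0#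
  below m 1≤m m≤2k-1 = trans (LHS≈ m {{ℕ.>-nonZero 1≤m}}) (linMul²-δ-below y₁ y₂ (2 ℕ.* k) m<2k)
    where
    m<2k : m < 2 ℕ.* k
    m<2k = ℕ.≤-trans (ℕ.≤-reflexive (ℕ.+-comm 1 m)) (ℕ.m≤o∸n⇒m+n≤o m 1≤2k m≤2k-1)
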